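{- For every $n\ge 1$, there is an exact affine OBDD with the identity variable order $(1,\dots,n)$, having $p(n)$ classical states and $n$ affine states, that computes the weighted sum function $\mathtt{WS}_n$.
   Context: $p(n)$ is the smallest prime greater than $n$. For $x\in\{0,1\}^n$ let $s_n(x)=\left(\sum_{i=1}^n i\cdot x_i\right)\bmod p(n)$. Then $\mathtt{WS}_n(x)=x_{s_n(x)}$ if $s_n(x)\in\{1,\dots,n\}$ and $\mathtt{WS}_n(x)=0$ otherwise. An affine OBDD (AfOBDD) is a tuple $(S,E,\delta,T,s_I,v_0,S_a,E_a,\pi)$: $S$ is a finite set of classical states with initial state $s_I$ and accepting set $S_a\subseteq S$; $E=\{e_1,\dots,e_{m_2}\}$ is a set of affine states with accepting set $E_a\subseteq E$; $v_0\in\mathbb{R}^{m_2}$ is an initial affine state (a real vector whose entries sum to $1$); $\pi$ is a permutation of the variable indices; for each step $i$, $\delta_i:S\times\{0,1\}\to S$; and for each step $i$, classical state $s$ and bit $b$ there is a real $m_2\times m_2$ matrix $T_i^{s,b}$ each of whose columns sums to $1$. On input $x$ it starts in $(s_I,v_0)$; at step $j$, from $(s,v_{j-1})$ it sets $v_j=T_j^{s,x_{\pi(j)}}v_{j-1}$ and then the classical state to $\delta_j(s,x_{\pi(j)})$. If the final classical state is not in $S_a$ the input is rejected; otherwise it is accepted with probability $\sum_{e_i\in E_a}|v_f[i]|/\|v_f\|_1$, $v_f$ the final affine state. It computes $f$ exactly if inputs with $f(x)=1$ are accepted with probability $1$ and inputs with $f(x)=0$ with probability $0$. -}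

module Defs where

open import Data.Nat as ℕ using (ℕ; zero; suc; _<_; _≤_; _≤?_)
open import Data.Nat.DivMod using (_%_)
open import Data.Nat.Primality using (Prime; prime⇒nonZero)
open import Data.Bool using (Bool; true; false; if_then_else_)
open import Data.Fin using (Fin; toℕ; fromℕ<)
open import Data.Fin.Permutation using (Permutation′; _⟨$⟩ʳ_)
open import Data.List using (List; foldl; allFin)
open import Data.Product using (_×_; _,_; proj₁; proj₂)
open import Data.Rational as ℚ using (ℚ; 0ℚ; 1ℚ; ∣_∣; _÷_; ≢-nonZero)
open import Data.Rational.Properties using () renaming (_≟_ to _≟ℚ_)
open import Relation.Nullary using (yes; no)
open import Relation.Nullary.Decidable using (⌊_⌋)
open import Relation.Binary.PropositionalEquality using (_≡_)

-- Convention: the variables x_1,…,x_n are indexed by Fin n, index i standing for x_{toℕ i + 1}.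

-- q is the smallest prime greater than n, i.e. q = p(n).
IsNextPrime : ℕ → ℕ → Set
IsNextPrime n q = Prime q × n < q × (∀ r → Prime r → n < r → q ≤ r)

bit : Bool → ℕ
bit true  = 1
bit false = 0


wsum : ∀ n → (Fin n → Bool) → ℕ
wsum n x = foldl (λ acc i → acc ℕ.+ suc (toℕ i) ℕ.* bit (x i)) 0 (allFin n)

WS : ∀ n q → .{{_ : ℕ.NonZero q}} → (Fin n → Bool) → Bool
WS n q x with wsum n x % q
... | zero  = false
... | suc k with suc k ≤? n
...   | yes sk≤n = x (fromℕ< sk≤n)
...   | no _     = false

∑ : ∀ {m} → (Fin m → ℚ) → ℚ
∑ {zero}  f = 0ℚ
∑ {suc m} f = f Data.Fin.zero ℚ.+ ∑ (λ i → f (Data.Fin.suc i))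

-- Affine OBDD on n variables with ms classical states and me affine states.
-- Real numbers are replaced by rationals.
-- T j s b i k is the (i,k) entry of the matrix T_j^{s,b}.
record AfOBDD (n ms me : ℕ) : Set where
  field
    sI  : Fin ms
    Sa  : Fin ms → Bool
    Ea  : Fin me → Bool
    v₀  : Fin me → ℚ
    v₀-sum : ∑ v₀ ≡ 1ℚ
    π   : Permutation′ n
    δ   : Fin n → Fin ms → Bool → Fin ms
    T   : Fin n → Fin ms → Bool → Fin me → Fin me → ℚ
    T-col : ∀ j s b k → ∑ (λ i → T j s b i k) ≡ 1ℚ

module _ {n ms me : ℕ} (A : AfOBDD n ms me) where
  open AfOBDD A

  step : (Fin n → Bool) → (Fin ms × (Fin me → ℚ)) → Fin n → (Fin ms × (Fin me → ℚ))
  step x (s , v) j =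
    let b = x (π ⟨$⟩ʳ j) in
    δ j s b , (λ i → ∑ (λ k → T j s b i k ℚ.* v k))

  run : (Fin n → Bool) → Fin ms × (Fin me → ℚ)
  run x = foldl (step x) (sI , v₀) (allFin n)

  -- acceptance probability (the ℓ1 norm is never 0 since entries sum to 1;
  -- the fallback value 0 in that case is never used)
  accProb : (Fin n → Bool) → ℚ
  accProb x with run x
  ... | s , v with Sa s
  ...   | false = 0ℚ
  ...   | true with ∑ (λ i → ∣ v i ∣) ≟ℚ 0ℚ
  ...     | yes _ = 0ℚ
  ...     | no ≢0 = _÷_ (∑ (λ i → if Ea i then ∣ v i ∣ else 0ℚ)) (∑ (λ i → ∣ v i ∣)) {{≢-nonZero ≢0}}

ComputesExactly : ∀ {n ms me} → AfOBDD n ms me → ((Fin n → Bool) → Bool) → Set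
ComputesExactly {n} A f =
  ∀ (x : Fin n → Bool) →
    (f x ≡ true → accProb A x ≡ 1ℚ) × (f x ≡ false → accProb A x ≡ 0ℚ)

IdentityOrder : ∀ {n ms me} → AfOBDD n ms me → Set
IdentityOrder {n} A = ∀ (j : Fin n) → AfOBDD.π A ⟨$⟩ʳ j ≡ j

primeNonZero : ∀ {n q} → IsNextPrime n q → ℕ.NonZero q
primeNonZero (pr , _ , _) = prime⇒nonZero pr

{-# OPTIONS --safe #-}
module Submission where

-- The classical state carries the running weighted sum modulo q. The affine state starts at e_0,
-- and reading x_j = 1 for j < n moves one unit of weight from e_0 to e_j; this needs the signed
-- matrix I + (e_j − e_0)𝟏ᵀ, which is affine but not stochastic. When x_n is read, the classical
-- state knows t = s_n(x), and a last matrix sends the affine state to e_t if x_t = 1 and to e_0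
-- otherwise. As e_0 is the only rejecting affine state, the acceptance probability is WS_n(x).

open import Defs
open import Data.Bool using (Bool; true; false; if_then_else_; _∧_)
open import Data.Empty using (⊥-elim)
open import Data.Fin using (Fin; zero; suc; toℕ; fromℕ<)
import Data.Fin.Permutation as Permutation
import Data.Fin.Properties as Fin
open import Data.List using (foldl; tabulate)
open import Data.Nat as ℕ using (ℕ; zero; suc; _≤_; _<_; s≤s; z≤n; _≡ᵇ_; _<ᵇ_; _≤?_; _<?_; _≟_; NonZero)
open import Data.Nat.DivMod using (_%_; m%n<n; %-distribˡ-+; m%n%n≡m%n)
open import Data.Nat.Properties
  using (suc-injective; ≤-refl; ≤-reflexive; ≤-antisym; ≤-trans; ≤-pred; <-trans; <-irrefl; <-cmp; <⇒≤; <⇒≯; <⇒≱; ≮⇒≥; n<1+n; m<n⇒m<1+n)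
open import Data.Product using (Σ; _×_; _,_; proj₁; proj₂)
open import Data.Rational using (ℚ; 0ℚ; 1ℚ; _+_; _-_; _*_; _÷_; ∣_∣; ≢-nonZero)
import Data.Rational.Properties as ℚ
open import Data.Rational.Solver using (module +-*-Solver)
open import Function using (_∘_; id; mk⇔)
open import Relation.Binary using (tri<; tri≈; tri>)
open import Relation.Binary.PropositionalEquality
open import Relation.Nullary using (yes; no)
open import Relation.Nullary.Decidable using (dec-true; dec-false; does-⇔)

open +-*-Solver

𝟙 : Bool → ℚ
𝟙 true  = 1ℚ
𝟙 false = 0ℚ

∣𝟙∣ : ∀ b → ∣ 𝟙 b ∣ ≡ 𝟙 b
∣𝟙∣ true  = refl
∣𝟙∣ false = refl

if-as-sum : ∀ c α β y → (if c then α else β) * y ≡ β * y + (α - β) * (𝟙 c * y)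
if-as-sum true  = solve 3 (λ α β y → α :* y := β :* y :+ (α :- β) :* (con 1ℚ :* y)) refl
if-as-sum false = solve 3 (λ α β y → β :* y := β :* y :+ (α :- β) :* (con 0ℚ :* y)) refl

blend-self : ∀ β y → β + (β - β) * y ≡ β
blend-self = solve 2 (λ β y → β :+ (β :- β) :* y := β) refl

blend : ∀ α β c → β + (α - β) * 𝟙 c ≡ (if c then α else β)
blend α β true  = solve 2 (λ α β → β :+ (α :- β) :* con 1ℚ := α) refl α β
blend α β false = solve 2 (λ α β → β :+ (α :- β) :* con 0ℚ := β) refl α β

≡ᵇ-comm : ∀ m n → (m ≡ᵇ n) ≡ (n ≡ᵇ m)
≡ᵇ-comm m n = does-⇔ (mk⇔ sym sym) (m ≟ n) (n ≟ m)

-- The unit vector e_t, which is the zero vector when t ≥ n.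
basis : ∀ {n} → ℕ → Fin n → ℚ
basis t i = 𝟙 (toℕ i ≡ᵇ t)

coord : ∀ {n} → (Fin n → ℚ) → ℕ → ℚ
coord v t = ∑ (λ k → basis t k * v k)

∑-cong : ∀ {n} {f g : Fin n → ℚ} → f ≗ g → ∑ f ≡ ∑ g
∑-cong {zero}  f≗g = refl
∑-cong {suc n} f≗g = cong₂ _+_ (f≗g zero) (∑-cong (f≗g ∘ suc))

∑-0 : ∀ {n} → ∑ {n} (λ _ → 0ℚ) ≡ 0ℚ
∑-0 {zero}  = refl
∑-0 {suc n} = cong (0ℚ +_) (∑-0 {n})

∑-+ : ∀ {n} (f g : Fin n → ℚ) → ∑ (λ i → f i + g i) ≡ ∑ f + ∑ g
∑-+ {zero}  f g = refl
∑-+ {suc n} f g = trans (cong (f zero + g zero +_) (∑-+ (f ∘ suc) (g ∘ suc)))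
  (solve 4 (λ a b c d → (a :+ b) :+ (c :+ d) := (a :+ c) :+ (b :+ d)) refl
    (f zero) (g zero) (∑ (f ∘ suc)) (∑ (g ∘ suc)))

∑-- : ∀ {n} (f g : Fin n → ℚ) → ∑ (λ i → f i - g i) ≡ ∑ f - ∑ g
∑-- {zero}  f g = refl
∑-- {suc n} f g = trans (cong (f zero - g zero +_) (∑-- (f ∘ suc) (g ∘ suc)))
  (solve 4 (λ a b c d → (a :- b) :+ (c :- d) := (a :+ c) :- (b :+ d)) refl
    (f zero) (g zero) (∑ (f ∘ suc)) (∑ (g ∘ suc)))

∑-*ˡ : ∀ {n} c (f : Fin n → ℚ) → ∑ (λ i → c * f i) ≡ c * ∑ f
∑-*ˡ {zero}  c f = sym (ℚ.*-zeroʳ c)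
∑-*ˡ {suc n} c f = trans (cong (c * f zero +_) (∑-*ˡ c (f ∘ suc)))
  (sym (ℚ.*-distribˡ-+ c (f zero) (∑ (f ∘ suc))))

∑-basis : ∀ {n t} → t < n → ∑ (basis {n} t) ≡ 1ℚ
∑-basis {suc n} {zero}  _           = cong (1ℚ +_) (∑-0 {n})
∑-basis {suc n} {suc t} (s≤s t<n) = cong (0ℚ +_) (∑-basis t<n)

coord-suc : ∀ {n} (v : Fin (suc n) → ℚ) t → coord v (suc t) ≡ coord (v ∘ suc) t
coord-suc v t = trans (cong (_+ coord (v ∘ suc) t) (ℚ.*-zeroˡ (v zero))) (ℚ.+-identityˡ _)

coord-toℕ : ∀ {n} (v : Fin n → ℚ) i → coord v (toℕ i) ≡ v i
coord-toℕ v zero = begin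
  1ℚ * v zero + ∑ (λ k → 0ℚ * v (suc k)) ≡⟨ cong (1ℚ * v zero +_) (trans (∑-*ˡ 0ℚ (v ∘ suc)) (ℚ.*-zeroˡ (∑ (v ∘ suc)))) ⟩
  1ℚ * v zero + 0ℚ                        ≡⟨ solve 1 (λ a → con 1ℚ :* a :+ con 0ℚ := a) refl (v zero) ⟩
  v zero                                  ∎
  where open ≡-Reasoning
coord-toℕ v (suc i) = trans (coord-suc v (toℕ i)) (coord-toℕ (v ∘ suc) i)

coord-≥ : ∀ {n} (v : Fin n → ℚ) {t} → n ≤ t → coord v t ≡ 0ℚ
coord-≥ {zero}  v         _         = refl
coord-≥ {suc n} v {suc t} (s≤s n≤t) = trans (coord-suc v t) (coord-≥ (v ∘ suc) n≤t)

module _ {n : ℕ} where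

  -- I + (e_a − e_0)𝟏ᵀ: on vectors of total weight 1 it moves one unit of weight from e_0 to e_a.
  shift : ℕ → Fin n → Fin n → ℚ
  shift a i k = basis (toℕ i) k + (basis a i - basis 0 i)

  ∑-moved : ∀ (v : Fin n → ℚ) {a} → a < n → ∑ (λ i → v i + (basis a i - basis 0 i)) ≡ ∑ v
  ∑-moved v {a} a<n = begin
    ∑ (λ i → v i + (eₐ i - e₀ i)) ≡⟨ ∑-+ v (λ i → eₐ i - e₀ i) ⟩
    ∑ v + ∑ (λ i → eₐ i - e₀ i)   ≡⟨ cong (∑ v +_) (∑-- eₐ e₀) ⟩
    ∑ v + (∑ eₐ - ∑ e₀)           ≡⟨ cong₂ (λ u w → ∑ v + (u - w)) (∑-basis a<n) (∑-basis (≤-trans (s≤s z≤n) a<n)) ⟩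
    ∑ v + (1ℚ - 1ℚ)               ≡⟨ ℚ.+-identityʳ (∑ v) ⟩
    ∑ v                           ∎
    where
    open ≡-Reasoning
    eₐ e₀ : Fin n → ℚ
    eₐ = basis a
    e₀ = basis 0

  shift-columns : ∀ {a} → a < n → ∀ (k : Fin n) → ∑ (λ i → shift a i k) ≡ 1ℚ
  shift-columns {a} a<n k = trans (∑-moved diagonal a<n) ∑-diagonal
    where
    diagonal : Fin n → ℚ
    diagonal i = basis (toℕ i) k
    ∑-diagonal : ∑ diagonal ≡ 1ℚ
    ∑-diagonal = trans (∑-cong {n} (λ i → cong 𝟙 (≡ᵇ-comm (toℕ k) (toℕ i)))) (∑-basis (Fin.toℕ<n k))

  shift-apply : ∀ a (v : Fin n → ℚ) → ∑ v ≡ 1ℚ →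
                ∀ i → ∑ (λ k → shift a i k * v k) ≡ v i + (basis a i - basis 0 i)
  shift-apply a v ∑v≡1 i = begin
    ∑ (λ k → shift a i k * v k)                    ≡⟨ ∑-cong (λ k → ℚ.*-distribʳ-+ (v k) (basis (toℕ i) k) d) ⟩
    ∑ (λ k → basis (toℕ i) k * v k + d * v k)      ≡⟨ ∑-+ (λ k → basis (toℕ i) k * v k) (λ k → d * v k) ⟩
    coord v (toℕ i) + ∑ (λ k → d * v k)            ≡⟨ cong₂ _+_ (coord-toℕ v i) (trans (∑-*ˡ d v) (cong (d *_) ∑v≡1)) ⟩
    v i + d * 1ℚ                                   ≡⟨ cong (v i +_) (ℚ.*-identityʳ d) ⟩
    v i + d                                        ∎
    where
    open ≡-Reasoning
    d = basis a i - basis 0 i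

  collapse : ℕ → ℕ → Fin n → Fin n → ℚ
  collapse t z i k = if toℕ k ≡ᵇ t then basis t i else basis z i

  collapse-columns : ∀ {t z} → z < n → ∀ (k : Fin n) → ∑ (λ i → collapse t z i k) ≡ 1ℚ
  collapse-columns {t = t} z<n k with toℕ k ≟ t
  ... | yes refl rewrite dec-true (toℕ k ≟ toℕ k) refl = ∑-basis (Fin.toℕ<n k)
  ... | no k≢t   rewrite dec-false (toℕ k ≟ t) k≢t     = ∑-basis z<n

  collapse-apply : ∀ t z (v : Fin n → ℚ) → ∑ v ≡ 1ℚ →
                   ∀ i → ∑ (λ k → collapse t z i k * v k) ≡ basis z i + (basis t i - basis z i) * coord v t
  collapse-apply t z v ∑v≡1 i = begin
    ∑ (λ k → collapse t z i k * v k)                          ≡⟨ ∑-cong (λ k → if-as-sum (toℕ k ≡ᵇ t) α β (v k)) ⟩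
    ∑ (λ k → β * v k + (α - β) * (basis t k * v k))           ≡⟨ ∑-+ (λ k → β * v k) _ ⟩
    ∑ (λ k → β * v k) + ∑ (λ k → (α - β) * (basis t k * v k)) ≡⟨ cong₂ _+_ (∑-*ˡ β v) (∑-*ˡ (α - β) (λ k → basis t k * v k)) ⟩
    β * ∑ v + (α - β) * coord v t                             ≡⟨ cong (λ u → β * u + (α - β) * coord v t) ∑v≡1 ⟩
    β * 1ℚ + (α - β) * coord v t                              ≡⟨ cong (_+ (α - β) * coord v t) (ℚ.*-identityʳ β) ⟩
    β + (α - β) * coord v t                                   ∎
    where
    open ≡-Reasoning
    α = basis t i
    β = basis z i

module _ {n ms me} (A : AfOBDD n ms me) (x : Fin n → Bool) where
  open AfOBDD A

  accProb-normalised : Sa (proj₁ (run A x)) ≡ true → ∑ (λ i → ∣ proj₂ (run A x) i ∣) ≡ 1ℚ →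
                       accProb A x ≡ ∑ (λ i → if Ea i then ∣ proj₂ (run A x) i ∣ else 0ℚ)
  accProb-normalised accepted norm with run A x
  ... | s , v with Sa s
  ...   | true with ∑ (λ i → ∣ v i ∣) ℚ.≟ 0ℚ
  ...     | yes norm≡0 = ⊥-elim (1≢0 (trans (sym norm) norm≡0))
    where
    1≢0 : 1ℚ ≢ 0ℚ
    1≢0 ()
  ...     | no norm≢0 = ÷-by-1 _ {{≢-nonZero norm≢0}} norm
    where
    ÷-by-1 : ∀ p {d} .{{_ : Data.Rational.NonZero d}} → d ≡ 1ℚ → p ÷ d ≡ p
    ÷-by-1 p refl = ℚ.*-identityʳ p

  accProb-basis : ∀ r → Sa (proj₁ (run A x)) ≡ true → proj₂ (run A x) ≗ basis (toℕ r) → accProb A x ≡ 𝟙 (Ea r)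
  accProb-basis r accepted v≗e = begin
    accProb A x                                                   ≡⟨ accProb-normalised accepted norm ⟩
    ∑ (λ i → if Ea i then ∣ proj₂ (run A x) i ∣ else 0ℚ)        ≡⟨ ∑-cong accepting ⟩
    coord (𝟙 ∘ Ea) (toℕ r)                                       ≡⟨ coord-toℕ (𝟙 ∘ Ea) r ⟩
    𝟙 (Ea r)                                                      ∎
    where
    open ≡-Reasoning
    ∣v∣≗e : ∀ i → ∣ proj₂ (run A x) i ∣ ≡ basis (toℕ r) i
    ∣v∣≗e i = trans (cong ∣_∣ (v≗e i)) (∣𝟙∣ (toℕ i ≡ᵇ toℕ r))
    norm : ∑ (λ i → ∣ proj₂ (run A x) i ∣) ≡ 1ℚ
    norm = trans (∑-cong ∣v∣≗e) (∑-basis (Fin.toℕ<n r))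
    if-𝟙 : ∀ c d → (if c then 𝟙 d else 0ℚ) ≡ 𝟙 d * 𝟙 c
    if-𝟙 true  true  = refl
    if-𝟙 true  false = refl
    if-𝟙 false true  = refl
    if-𝟙 false false = refl
    accepting : ∀ i → (if Ea i then ∣ proj₂ (run A x) i ∣ else 0ℚ) ≡ basis (toℕ r) i * 𝟙 (Ea i)
    accepting i = trans (cong (if Ea i then_else 0ℚ) (∣v∣≗e i)) (if-𝟙 (Ea i) (toℕ i ≡ᵇ toℕ r))

  accProb-rejected : Sa (proj₁ (run A x)) ≡ false → accProb A x ≡ 0ℚ
  accProb-rejected rejected with run A x
  ... | s , v with Sa s
  ...   | false = refl

computesExactly-𝟙 : ∀ {n ms me} (A : AfOBDD n ms me) f → (∀ x → accProb A x ≡ 𝟙 (f x)) → ComputesExactly A f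
computesExactly-𝟙 A f acc x = (λ fx → trans (acc x) (cong 𝟙 fx)) , (λ fx → trans (acc x) (cong 𝟙 fx))

foldl-tabulate-simulation : ∀ {A B C : Set} {n} (R : ℕ → A → B → Set) (f : A → C → A) (g : B → C → B) (h : Fin n → C) →
  (∀ i {a b} → R (toℕ i) a b → R (suc (toℕ i)) (f a (h i)) (g b (h i))) →
  ∀ a b → R 0 a b → R n (foldl f a (tabulate h)) (foldl g b (tabulate h))
foldl-tabulate-simulation {n = zero}  R f g h step a b r = r
foldl-tabulate-simulation {n = suc n} R f g h step a b r =
  foldl-tabulate-simulation (R ∘ suc) f g (h ∘ suc) (λ i → step (suc i)) (f a (h zero)) (g b (h zero)) (step zero r)

bitAt : ∀ {n} → (Fin n → Bool) → ℕ → Bool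
bitAt {n} x k with suc k ≤? n
... | yes k<n = x (fromℕ< k<n)
... | no _    = false

bitAt-fromℕ< : ∀ {n} (x : Fin n → Bool) {k} (k<n : k < n) → bitAt x k ≡ x (fromℕ< k<n)
bitAt-fromℕ< {n} x {k} k<n with suc k ≤? n
... | yes _   = refl
... | no k≮n = ⊥-elim (k≮n k<n)

bitAt-toℕ : ∀ {n} (x : Fin n → Bool) j → bitAt x (toℕ j) ≡ x j
bitAt-toℕ x j = trans (bitAt-fromℕ< x (Fin.toℕ<n j)) (cong x (Fin.fromℕ<-toℕ j _))

bitAt-≥ : ∀ {n} (x : Fin n → Bool) {k} → n ≤ k → bitAt x k ≡ false
bitAt-≥ {n} x {k} n≤k with suc k ≤? n
... | yes k<n = ⊥-elim (<⇒≱ k<n n≤k)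
... | no _    = refl

selected : ∀ {n} → (Fin n → Bool) → ℕ → Bool
selected x zero    = false
selected x (suc k) = bitAt x k

WS≡selected : ∀ {n q} .{{_ : NonZero q}} (x : Fin n → Bool) → WS n q x ≡ selected x (wsum n x % q)
WS≡selected {n} {q} x with wsum n x % q
... | zero  = refl
... | suc k with suc k ≤? n
...   | yes _ = refl
...   | no _  = refl

positive : ∀ {n} → Fin n → Bool
positive zero    = false
positive (suc _) = true

mark : Bool → ℕ → ℕ
mark b j = if b then suc j else 0

mark-< : ∀ b {j n} → suc j < n → mark b j < n
mark-< true  j+1<n = j+1<n
mark-< false j+1<n = ≤-trans (s≤s z≤n) j+1<n

mark-≢ : ∀ b {k j} → k ≢ j → (suc k ≡ᵇ mark b j) ≡ false
mark-≢ true  {k} {j} k≢j = dec-false (k ≟ j) k≢j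
mark-≢ false k≢j = refl

mark-self : ∀ b j → (suc j ≡ᵇ mark b j) ≡ b
mark-self true  j = dec-true (j ≟ j) refl
mark-self false j = refl

-- The update of `memory` below at coordinate k + 1, where e_0 vanishes.
memory-coordinate-step : ∀ (f : ℕ → Bool) k j →
  𝟙 ((k <ᵇ j) ∧ f k) + (𝟙 (suc k ≡ᵇ mark (f j) j) - 0ℚ) ≡ 𝟙 ((k <ᵇ suc j) ∧ f k)
memory-coordinate-step f k j with <-cmp k j
... | tri< k<j k≢j _
  rewrite dec-true (k <? j) k<j | dec-true (k <? suc j) (m<n⇒m<1+n k<j) | mark-≢ (f j) k≢j
  = ℚ.+-identityʳ (𝟙 (f k))
... | tri≈ _ refl _
  rewrite dec-false (k <? k) (<-irrefl refl) | dec-true (k <? suc k) (n<1+n k) | mark-self (f k) k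
  = trans (ℚ.+-identityˡ (𝟙 (f k) - 0ℚ)) (ℚ.+-identityʳ (𝟙 (f k)))
... | tri> _ k≢j j<k
  rewrite dec-false (k <? j) (<⇒≯ j<k) | dec-false (k <? suc j) (λ k<j+1 → <⇒≱ j<k (≤-pred k<j+1)) | mark-≢ (f j) k≢j
  = refl

module WeightedSumAutomaton (m q₀ : ℕ) where

  n q : ℕ
  n = suc (suc m)
  q = suc q₀

  0<n : 0 < n
  0<n = s≤s z≤n

  next : Fin n → Fin q → Bool → Fin q
  next j s b = fromℕ< (m%n<n (toℕ s ℕ.+ suc (toℕ j) ℕ.* bit b) q)

  toℕ-next : ∀ j {s} b {acc} → toℕ s ≡ acc % q → toℕ (next j s b) ≡ (acc ℕ.+ suc (toℕ j) ℕ.* bit b) % q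
  toℕ-next j {s} b {acc} s≡acc = begin
    toℕ (next j s b)       ≡⟨ Fin.toℕ-fromℕ< _ ⟩
    (toℕ s ℕ.+ w) % q      ≡⟨ cong (λ u → (u ℕ.+ w) % q) s≡acc ⟩
    (acc % q ℕ.+ w) % q    ≡⟨ %-distribˡ-+ (acc % q) w q ⟩
    (acc % q % q ℕ.+ w % q) % q ≡⟨ cong (λ u → (u ℕ.+ w % q) % q) (m%n%n≡m%n acc q) ⟩
    (acc % q ℕ.+ w % q) % q ≡⟨ %-distribˡ-+ acc w q ⟨
    (acc ℕ.+ w) % q        ∎
    where
    open ≡-Reasoning
    w = suc (toℕ j) ℕ.* bit b

  -- The last matrix sends every column other than t to e_(sink t b). The last variable has no
  -- coordinate of its own, so for t = n the bit b just read is sent directly to e_1 or e_0.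
  sink : ℕ → Bool → ℕ
  sink t b = if t ≡ᵇ n then bit b else 0

  transition : Fin n → Fin q → Bool → Fin n → Fin n → ℚ
  transition j s b with suc (toℕ j) <? n
  ... | yes _ = shift (mark b (toℕ j))
  ... | no _  = collapse t (sink t b)
    where t = toℕ (next j s b)

  transition-columns : ∀ j s b k → ∑ (λ i → transition j s b i k) ≡ 1ℚ
  transition-columns j s b k with suc (toℕ j) <? n
  ... | yes j+1<n = shift-columns (mark-< b j+1<n) k
  ... | no _ = collapse-columns (sink<n (toℕ (next j s b)) b) k
    where
    sink<n : ∀ t b → sink t b < n
    sink<n t b with t ≡ᵇ n | b
    ... | true  | true  = s≤s (s≤s z≤n)
    ... | true  | false = 0<n
    ... | false | _     = 0<n

  automaton : AfOBDD n q n
  automaton = record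
    { sI     = zero
    ; Sa     = λ _ → true
    ; Ea     = positive
    ; v₀     = basis 0
    ; v₀-sum = ∑-basis 0<n
    ; π      = Permutation.id
    ; δ      = next
    ; T      = transition
    ; T-col  = transition-columns
    }

  module _ (x : Fin n → Bool) where

    memory : ℕ → Fin n → ℚ
    memory zero      = basis 0
    memory (suc j) i = memory j i + (basis (mark (bitAt x j) j) i - basis 0 i)

    ∑-memory : ∀ {j} → j < n → ∑ (memory j) ≡ 1ℚ
    ∑-memory {zero}  _     = ∑-basis 0<n
    ∑-memory {suc j} j+1<n =
      trans (∑-moved (memory j) (mark-< (bitAt x j) j+1<n)) (∑-memory (<-trans (n<1+n j) j+1<n))

    memory-coordinate : ∀ j k (i : Fin n) → toℕ i ≡ suc k → memory j i ≡ 𝟙 ((k <ᵇ j) ∧ bitAt x k)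
    memory-coordinate zero    k i i≡k+1 rewrite i≡k+1 = refl
    memory-coordinate (suc j) k i i≡k+1 rewrite memory-coordinate j k i i≡k+1 | i≡k+1 = memory-coordinate-step (bitAt x) k j

    coord-memory : ∀ {k} → suc k < n → coord (memory (suc m)) (suc k) ≡ 𝟙 (bitAt x k)
    coord-memory {k} k+1<n = begin
      coord (memory (suc m)) (suc k)     ≡⟨ cong (coord (memory (suc m))) (sym (Fin.toℕ-fromℕ< k+1<n)) ⟩
      coord (memory (suc m)) (toℕ i)     ≡⟨ coord-toℕ (memory (suc m)) i ⟩
      memory (suc m) i                   ≡⟨ memory-coordinate (suc m) k i (Fin.toℕ-fromℕ< k+1<n) ⟩
      𝟙 ((k <ᵇ suc m) ∧ bitAt x k)       ≡⟨ cong (λ c → 𝟙 (c ∧ bitAt x k)) (dec-true (k <? suc m) (≤-pred k+1<n)) ⟩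
      𝟙 (bitAt x k)                      ∎
      where
      open ≡-Reasoning
      i = fromℕ< k+1<n

    record Verdict (t : ℕ) (w : Fin n → ℚ) : Set where
      constructor verdict
      field
        final             : Fin n
        is-basis          : w ≗ basis (toℕ final)
        positive≡selected : positive final ≡ selected x t

    Verdict-cong : ∀ {t w w′} → w ≗ w′ → Verdict t w′ → Verdict t w
    Verdict-cong w≗w′ (verdict r w′≗e sel) = verdict r (λ i → trans (w≗w′ i) (w′≗e i)) sel

    verdict-reject : ∀ {t w} → selected x t ≡ false → w ≗ basis 0 → Verdict t w
    verdict-reject sel w≗e₀ = verdict zero w≗e₀ (sym sel)

    verdict-if : ∀ {t w} (r : Fin n) → positive r ≡ true → ∀ c → selected x t ≡ c →
                 (∀ i → w i ≡ (if c then basis (toℕ r) i else basis 0 i)) → Verdict t w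
    verdict-if r pos true  sel w≗e = verdict r w≗e (trans pos (sym sel))
    verdict-if r pos false sel w≗e = verdict-reject sel w≗e

    read-out : ∀ t b → bitAt x (suc m) ≡ b →
               Verdict t (λ i → basis (sink t b) i + (basis t i - basis (sink t b) i) * coord (memory (suc m)) t)
    read-out zero b _ = verdict-reject refl (λ i → blend-self (basis 0 i) _)
    read-out (suc k) b last≡b with <-cmp (suc k) n
    ... | tri< k+1<n k+1≢n _
      rewrite dec-false (suc k ≟ n) k+1≢n | coord-memory k+1<n
      = verdict-if (fromℕ< k+1<n) refl (bitAt x k) refl
          (λ i → trans (blend (basis (suc k) i) (basis 0 i) (bitAt x k))
                       (cong (λ r → if bitAt x k then basis r i else basis 0 i) (sym (Fin.toℕ-fromℕ< k+1<n))))
    ... | tri≈ _ k+1≡n _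
      rewrite dec-true (suc k ≟ n) k+1≡n | coord-≥ (memory (suc m)) (≤-reflexive (sym k+1≡n))
      = verdict-if (suc zero) refl b (trans (cong (bitAt x) (suc-injective k+1≡n)) last≡b)
          (λ i → trans (blend (basis (suc k) i) (basis (bit b) i) false) (basis-bit b i))
      where
      basis-bit : ∀ b i → basis (bit b) i ≡ (if b then basis 1 i else basis 0 i)
      basis-bit true  i = refl
      basis-bit false i = refl
    ... | tri> _ k+1≢n n<k+1
      rewrite dec-false (suc k ≟ n) k+1≢n | coord-≥ (memory (suc m)) (<⇒≤ n<k+1)
      = verdict-reject (bitAt-≥ x {k} (≤-pred n<k+1)) (λ i → blend (basis (suc k) i) (basis 0 i) false)

    Invariant : ℕ → Fin q × (Fin n → ℚ) → ℕ → Set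
    Invariant j (s , v) acc = toℕ s ≡ acc % q × (j < n → v ≗ memory j) × (j ≡ n → Verdict (acc % q) v)

    invariant-start : Invariant 0 (zero , basis 0) 0
    invariant-start = refl , (λ _ _ → refl) , λ ()

    recording-step : ∀ j {v} → v ≗ memory (toℕ j) →
                     ∀ i → ∑ (λ k → shift (mark (x j) (toℕ j)) i k * v k) ≡ memory (suc (toℕ j)) i
    recording-step j {v} v≗M i = begin
      ∑ (λ k → shift a i k * v k)   ≡⟨ shift-apply a v (trans (∑-cong v≗M) (∑-memory (Fin.toℕ<n j))) i ⟩
      v i + (basis a i - basis 0 i) ≡⟨ cong₂ (λ u b → u + (basis (mark b (toℕ j)) i - basis 0 i)) (v≗M i) (sym (bitAt-toℕ x j)) ⟩
      memory (suc (toℕ j)) i        ∎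
      where
      open ≡-Reasoning
      a = mark (x j) (toℕ j)

    final-step : ∀ t b {v} → bitAt x (suc m) ≡ b → v ≗ memory (suc m) →
                 Verdict t (λ i → ∑ (λ k → collapse t (sink t b) i k * v k))
    final-step t b {v} last≡b v≗M = Verdict-cong collapsed (read-out t b last≡b)
      where
      z = sink t b
      collapsed : ∀ i → ∑ (λ k → collapse t z i k * v k) ≡ basis z i + (basis t i - basis z i) * coord (memory (suc m)) t
      collapsed i = trans (collapse-apply t z v (trans (∑-cong v≗M) (∑-memory ≤-refl)) i)
        (cong (λ c → basis z i + (basis t i - basis z i) * c) (∑-cong (λ k → cong (basis t k *_) (v≗M k))))

    invariant-step : ∀ j {st acc} → Invariant (toℕ j) st acc →
                     Invariant (suc (toℕ j)) (step automaton x st j) (acc ℕ.+ suc (toℕ j) ℕ.* bit (x j))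
    invariant-step j {s , v} {acc} (s≡acc , recorded , _) with suc (toℕ j) <? n
    ... | yes j+1<n = s≡sum , (λ _ → recording-step j (recorded (Fin.toℕ<n j)))
                          , (λ j+1≡n → ⊥-elim (<-irrefl j+1≡n j+1<n))
      where s≡sum = toℕ-next j (x j) {acc} s≡acc
    ... | no j+1≮n  = s≡sum , (λ j+1<n → ⊥-elim (j+1≮n j+1<n))
                          , (λ _ → subst (λ t′ → Verdict t′ w) s≡sum final)
      where
      s≡sum = toℕ-next j (x j) {acc} s≡acc
      j≡m+1 : toℕ j ≡ suc m
      j≡m+1 = ≤-antisym (≤-pred (Fin.toℕ<n j)) (≤-pred (≮⇒≥ j+1≮n))
      t = toℕ (next j s (x j))
      w = λ i → ∑ (λ k → collapse t (sink t (x j)) i k * v k)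
      final : Verdict t w
      final = final-step t (x j) (trans (cong (bitAt x) (sym j≡m+1)) (bitAt-toℕ x j))
                (subst (λ l → v ≗ memory l) j≡m+1 (recorded (Fin.toℕ<n j)))

    run-invariant : Invariant n (run automaton x) (wsum n x)
    run-invariant =
      foldl-tabulate-simulation Invariant (step automaton x) (λ acc i → acc ℕ.+ suc (toℕ i) ℕ.* bit (x i)) id
        invariant-step (zero , basis 0) 0 invariant-start

    accepts : accProb automaton x ≡ 𝟙 (WS n q x)
    accepts = trans (accProb-basis automaton x final refl is-basis)
                    (cong 𝟙 (trans positive≡selected (sym (WS≡selected x))))
      where open Verdict (proj₂ (proj₂ run-invariant) refl)

  computes : ComputesExactly automaton (WS n q)
  computes = computesExactly-𝟙 automaton (WS n q) accepts

-- With a single affine state there is no rejecting one, so the classical state decides.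
module SingleVariable (q₀ : ℕ) where

  q : ℕ
  q = suc (suc q₀)

  bit-state : Bool → Fin q
  bit-state b = if b then suc zero else zero

  automaton : AfOBDD 1 q 1
  automaton = record
    { sI     = zero
    ; Sa     = positive
    ; Ea     = λ _ → true
    ; v₀     = λ _ → 1ℚ
    ; v₀-sum = refl
    ; π      = Permutation.id
    ; δ      = λ _ _ → bit-state
    ; T      = λ _ _ _ _ _ → 1ℚ
    ; T-col  = λ _ _ _ _ → refl
    }

  WS-single : ∀ x → WS 1 q x ≡ x zero
  WS-single x = trans (WS≡selected x) (selected-bit (x zero) refl)
    where
    selected-bit : ∀ b → x zero ≡ b → selected x ((0 ℕ.+ 1 ℕ.* bit b) % q) ≡ b
    selected-bit true  x₀ = x₀
    selected-bit false x₀ = refl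

  accProb-single : ∀ x → accProb automaton x ≡ 𝟙 (x zero)
  accProb-single x = accProb-bit (x zero) refl
    where
    accProb-bit : ∀ b → x zero ≡ b → accProb automaton x ≡ 𝟙 b
    accProb-bit true  x₀ = accProb-basis automaton x zero (cong (positive ∘ bit-state) x₀) (λ { zero → refl })
    accProb-bit false x₀ = accProb-rejected automaton x (cong (positive ∘ bit-state) x₀)

  computes : ComputesExactly automaton (WS 1 q)
  computes = computesExactly-𝟙 automaton (WS 1 q) (λ x → trans (accProb-single x) (cong 𝟙 (sym (WS-single x))))

WS-automaton : ∀ {n q} .{{_ : NonZero q}} → 1 ≤ n → n < q →
               Σ (AfOBDD n q n) (λ A → IdentityOrder A × ComputesExactly A (WS n q))
WS-automaton {suc zero}    {suc (suc q₀)} _ _ = automaton , (λ _ → refl) , computes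
  where open SingleVariable q₀
WS-automaton {suc (suc m)} {suc q₀}       _ _ = automaton , (λ _ → refl) , computes
  where open WeightedSumAutomaton m q₀
WS-automaton {suc zero}    {suc zero}     _ (s≤s ())

theorem3 : ∀ (n : ℕ) → 1 ≤ n → ∀ (q : ℕ) → (nq : IsNextPrime n q) →
    Σ (AfOBDD n q n) (λ A → IdentityOrder A × ComputesExactly A (WS n q {{primeNonZero nq}}))
theorem3 n 1≤n q nq@(_ , n<q , _) = WS-automaton {{primeNonZero nq}} 1≤n n<q
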